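{- Let $G$ be a $V_4$-vertex magic graph, where $V_4\cong \mathbb{Z}_2\times\mathbb{Z}_2$ is the Klein four-group. Then $spec(G,V_4)$ is a subgroup of $V_4$ if and only if $0\in spec(G,V_4)$.
   Context: All graphs are finite, simple and connected. For an additive abelian group $A$ with identity $0$ and a graph $G$, an $A$-vertex magic labeling of $G$ is a map $l:V(G)\to A\setminus\{0\}$ for which there is $\mu\in A$ (the magic constant) such that $w(v):=\sum_{u\in N_G(v)} l(u)=\mu$ for every $v\in V(G)$. $G$ is $A$-vertex magic if it admits such a labeling. $spec(G,A)$ denotes the set of all magic constants of $A$-vertex magic labelings of $G$. -}

module Defs where

open import Data.Nat using (ℕ; zero; suc)
open import Data.Fin using (Fin; zero; suc)
open import Data.Bool using (Bool; true; false; if_then_else_; _xor_)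
open import Data.Product using (_×_; _,_; ∃; Σ)
open import Relation.Binary.PropositionalEquality using (_≡_; _≢_)
open import Relation.Nullary using (¬_)
open import Function.Bundles using (_⇔_)

V₄ : Set
V₄ = Bool × Bool

0V : V₄
0V = false , false

_⊕_ : V₄ → V₄ → V₄
(a , b) ⊕ (c , d) = (a xor c) , (b xor d)

-- additive inverse in V₄ (every element is its own inverse)
⊖_ : V₄ → V₄
⊖ x = x

ΣFin : (n : ℕ) → (Fin n → V₄) → V₄
ΣFin zero    f = 0V
ΣFin (suc n) f = f zero ⊕ ΣFin n (λ i → f (suc i))

data Walk {n : ℕ} (adj : Fin n → Fin n → Bool) : Fin n → Fin n → Set where
  here : ∀ {u} → Walk adj u u
  step : ∀ {u w v} → adj u w ≡ true → Walk adj w v → Walk adj u v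

record Graph (n : ℕ) : Set where
  field
    adj       : Fin n → Fin n → Bool
    symmetric : ∀ u v → adj u v ≡ adj v u
    loopless  : ∀ v → adj v v ≡ false
    connected : ∀ u v → Walk adj u v

open Graph public

weight : ∀ {n} → Graph n → (Fin n → V₄) → Fin n → V₄
weight {n} G l v = ΣFin n (λ u → if adj G v u then l u else 0V)

IsMagicLabeling : ∀ {n} → Graph n → (Fin n → V₄) → V₄ → Set
IsMagicLabeling {n} G l μ = (∀ v → l v ≢ 0V) × (∀ v → weight G l v ≡ μ)

Spec : ∀ {n} → Graph n → V₄ → Set
Spec {n} G μ = ∃ λ (l : Fin n → V₄) → IsMagicLabeling G l μ

IsV₄VertexMagic : ∀ {n} → Graph n → Set
IsV₄VertexMagic G = ∃ λ μ → Spec G μ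

IsSubgroup : (V₄ → Set) → Set
IsSubgroup S = S 0V × (∀ x y → S x → S y → S (x ⊕ y)) × (∀ x → S x → S (⊖ x))

{-# OPTIONS --safe #-}
module Submission where

-- The map σ (a , b) = (b , a xor b) is an automorphism of V₄ permuting its three nonzero
-- elements cyclically, and composing a magic labeling with an automorphism yields a magic
-- labeling whose constant is the image of the old one. Hence spec(G, V₄) contains either
-- no nonzero element or all of them; if 0 ∈ spec it is therefore {0} or V₄, a subgroup
-- either way.

open import Defs
open import Algebra.Bundles using (CommutativeRing)
open import Data.Bool using (true; false; if_then_else_; _xor_)
import Data.Bool.Properties as Bool
open import Data.Empty using (⊥-elim)
open import Data.Fin using (Fin; zero; suc)
open import Data.Nat using (ℕ; zero; suc)
open import Data.Product using (_,_; proj₁)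
open import Data.Product.Properties using (≡-dec)
open import Data.Sum using (_⊎_; inj₁; inj₂)
open import Function.Base using (_∘_; id)
open import Function.Bundles using (_⇔_; mk⇔)
open import Relation.Binary.Definitions using (DecidableEquality)
open import Relation.Binary.PropositionalEquality
open import Relation.Nullary using (yes; no)

open import Algebra.Properties.CommutativeSemigroup
  (CommutativeRing.+-commutativeSemigroup Bool.xor-∧-commutativeRing) using (interchange)

_≟_ : DecidableEquality V₄
_≟_ = ≡-dec Bool._≟_ Bool._≟_

x⊕x≡0V : ∀ x → x ⊕ x ≡ 0V
x⊕x≡0V (a , b) = cong₂ _,_ (Bool.xor-same a) (Bool.xor-same b)

ΣFin-cong : ∀ n {f g : Fin n → V₄} → (∀ i → f i ≡ g i) → ΣFin n f ≡ ΣFin n g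
ΣFin-cong zero    f≗g = refl
ΣFin-cong (suc n) f≗g = cong₂ _⊕_ (f≗g zero) (ΣFin-cong n (f≗g ∘ suc))

module _ {φ : V₄ → V₄} (φ-⊕ : ∀ x y → φ (x ⊕ y) ≡ φ x ⊕ φ y) where

  φ-0V : φ 0V ≡ 0V
  φ-0V = trans (φ-⊕ 0V 0V) (x⊕x≡0V (φ 0V))

  ΣFin-homo : ∀ n (f : Fin n → V₄) → ΣFin n (φ ∘ f) ≡ φ (ΣFin n f)
  ΣFin-homo zero    f = sym φ-0V
  ΣFin-homo (suc n) f = begin
    φ (f zero) ⊕ ΣFin n (φ ∘ f ∘ suc)  ≡⟨ cong (φ (f zero) ⊕_) (ΣFin-homo n (f ∘ suc)) ⟩
    φ (f zero) ⊕ φ (ΣFin n (f ∘ suc))  ≡⟨ φ-⊕ (f zero) _ ⟨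
    φ (ΣFin (suc n) f)                 ∎
    where open ≡-Reasoning

  if-homo : ∀ b x → (if b then φ x else 0V) ≡ φ (if b then x else 0V)
  if-homo true  x = refl
  if-homo false x = sym φ-0V

  weight-homo : ∀ {n} (G : Graph n) l v → weight G (φ ∘ l) v ≡ φ (weight G l v)
  weight-homo {n} G l v =
    trans (ΣFin-cong n (λ u → if-homo (adj G v u) (l u))) (ΣFin-homo n _)

  Spec-map : (∀ x → x ≢ 0V → φ x ≢ 0V) → ∀ {n} (G : Graph n) {μ} → Spec G μ → Spec G (φ μ)
  Spec-map φ-nonzero G (l , l≢0 , w≡μ) =
    φ ∘ l , (λ v → φ-nonzero (l v) (l≢0 v)) , λ v → trans (weight-homo G l v) (cong φ (w≡μ v))

σ : V₄ → V₄
σ (a , b) = b , a xor b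

σ-⊕ : ∀ x y → σ (x ⊕ y) ≡ σ x ⊕ σ y
σ-⊕ (a , b) (c , d) = cong (b xor d ,_) (interchange a c b d)

σ-nonzero : ∀ x → x ≢ 0V → σ x ≢ 0V
σ-nonzero (false , false) x≢0 = ⊥-elim (x≢0 refl)
σ-nonzero (false , true)  _   ()
σ-nonzero (true  , false) _   ()
σ-nonzero (true  , true)  _   ()

nonzero-σ-orbit : ∀ x y → x ≢ 0V → y ≢ 0V → y ≡ x ⊎ y ≡ σ x ⊎ y ≡ σ (σ x)
nonzero-σ-orbit (false , false) _               x≢0 _   = ⊥-elim (x≢0 refl)
nonzero-σ-orbit _               (false , false) _   y≢0 = ⊥-elim (y≢0 refl)
nonzero-σ-orbit (false , true)  (false , true)  _   _   = inj₁ refl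
nonzero-σ-orbit (false , true)  (true  , true)  _   _   = inj₂ (inj₁ refl)
nonzero-σ-orbit (false , true)  (true  , false) _   _   = inj₂ (inj₂ refl)
nonzero-σ-orbit (true  , true)  (true  , true)  _   _   = inj₁ refl
nonzero-σ-orbit (true  , true)  (true  , false) _   _   = inj₂ (inj₁ refl)
nonzero-σ-orbit (true  , true)  (false , true)  _   _   = inj₂ (inj₂ refl)
nonzero-σ-orbit (true  , false) (true  , false) _   _   = inj₁ refl
nonzero-σ-orbit (true  , false) (false , true)  _   _   = inj₂ (inj₁ refl)
nonzero-σ-orbit (true  , false) (true  , true)  _   _   = inj₂ (inj₂ refl)

module _ {n} (G : Graph n) where

  Spec-σ : ∀ {μ} → Spec G μ → Spec G (σ μ)
  Spec-σ = Spec-map {φ = σ} σ-⊕ σ-nonzero G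

  Spec-nonzero-transfer : ∀ {x y} → Spec G x → x ≢ 0V → y ≢ 0V → Spec G y
  Spec-nonzero-transfer {x} {y} sx x≢0 y≢0 with nonzero-σ-orbit x y x≢0 y≢0
  ... | inj₁ refl        = sx
  ... | inj₂ (inj₁ refl) = Spec-σ sx
  ... | inj₂ (inj₂ refl) = Spec-σ (Spec-σ sx)

  Spec-⊕-closed : Spec G 0V → ∀ x y → Spec G x → Spec G y → Spec G (x ⊕ y)
  Spec-⊕-closed s0 x y sx sy with (x ⊕ y) ≟ 0V | x ≟ 0V
  ... | yes x⊕y≡0 | _        = subst (Spec G) (sym x⊕y≡0) s0
  ... | no _      | yes refl = sy
  ... | no x⊕y≢0  | no x≢0   = Spec-nonzero-transfer sx x≢0 x⊕y≢0

mainTheorem2 : (n : ℕ) (G : Graph n) → IsV₄VertexMagic G →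
    (IsSubgroup (Spec G) ⇔ Spec G 0V)
mainTheorem2 n G _ = mk⇔ proj₁ λ s0 → s0 , Spec-⊕-closed G s0 , λ _ → id
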